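{- For positive integers $a,b,n$ with $n\ge2$ and $ab<n$, let \[F(a,b,n)=2+(n+2)(n-b-2\theta_a)-a(a+1)-(n-ab)(n-ab+1).\] Then $F(a,b,n)\ge0$.
   Context: $\theta_a$ denotes the best known bound towards the Generalized Ramanujan Conjecture for $\mathrm{GL}(a)$: $\theta_1=0$, $\theta_2=7/64$, $\theta_3=5/14$, $\theta_4=9/22$, and $\theta_a=\frac12-\frac{1}{a^2+1}$ for $a\ge5$. -}

module Defs where

open import Data.Nat as ℕ using (ℕ; zero; suc)
open import Data.Integer as ℤ using (ℤ; +_)
open import Data.Rational using (ℚ; _/_; _+_; _-_; _*_; 0ℚ)

-- θ_a : best known bound towards GRC for GL(a) (as in the paper).
-- θ 0 is a junk value (a is always positive in the statement).
θ : ℕ → ℚ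
θ 0 = 0ℚ
θ 1 = 0ℚ
θ 2 = + 7 / 64
θ 3 = + 5 / 14
θ 4 = + 9 / 22
θ a@(suc (suc (suc (suc (suc _))))) = + 1 / 2 - + 1 / suc (a ℕ.* a)

ι : ℕ → ℚ
ι n = + n / 1

F : ℕ → ℕ → ℕ → ℚ
F a b n =
  ι 2 + (ι n + ι 2) * (ι n - ι b - ι 2 * θ a)
      - ι a * (ι a + ι 1)
      - (ι n - ι a * ι b) * (ι n - ι a * ι b + ι 1)

-- Write a = 1 + x, b = 1 + y and n = 1 + ab + k. Then F(a,b,n) = P + R with
-- P = a(a-1)(b²-1) + 3(a-1)(b-1) + (2a-1)bk, visibly nonnegative, and
-- R = (a - 3) + (n + 2)(1 - 2θ_a). Since θ_a ≤ 1/2, R ≥ 0 for a ≥ 3; for a = 1, 2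
-- the deficit a - 3 is absorbed by n + 2 ≥ a + 3 and the explicit θ_1 = 0, θ_2 = 7/64.
module Submission where

open import Defs
open import Data.Nat using (ℕ; _≤_; _<_; _*_)
open import Data.Rational using (0ℚ) renaming (_≤_ to _≤ℚ_)
open import Data.Nat as ℕ using (suc)
open import Data.Nat.Properties using (m≤n⇒∃[o]m+o≡n)
open import Data.Nat.Coprimality using (1-coprimeTo) renaming (sym to coprime-sym)
open import Data.Integer using (+_)
import Data.Integer as ℤ
import Data.Integer.Properties as ℤ
open import Data.Product using (_,_)
open import Data.Rational using (ℚ; mkℚ; _/_; _+_; _-_; NonNegative; nonNegative) renaming (_*_ to _·_)
open import Data.Rational.Properties
  using (normalize-coprime; normalize-nonNeg; nonNegative⁻¹; +-mono-≤; nonNeg*nonNeg⇒nonNeg)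
open import Data.Rational.Solver using (module +-*-Solver)
open import Relation.Binary.PropositionalEquality
  using (_≡_; refl; sym; cong; cong₂; subst; module ≡-Reasoning)

open +-*-Solver
open ≡-Reasoning

ι-mkℚ : ∀ m → ι m ≡ mkℚ (+ m) 0 (coprime-sym (1-coprimeTo m))
ι-mkℚ m = normalize-coprime (coprime-sym (1-coprimeTo m))

ι-+ : ∀ m n → ι (m ℕ.+ n) ≡ ι m + ι n
ι-+ m n = sym (begin
  ι m + ι n
    ≡⟨ cong₂ _+_ (ι-mkℚ m) (ι-mkℚ n) ⟩
  (+ m ℤ.* + 1 ℤ.+ + n ℤ.* + 1) / 1
    ≡⟨ cong (_/ 1) (cong₂ ℤ._+_ (ℤ.*-identityʳ (+ m)) (ℤ.*-identityʳ (+ n))) ⟩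
  ι (m ℕ.+ n) ∎)

ι-* : ∀ m n → ι (m ℕ.* n) ≡ ι m · ι n
ι-* m n = sym (begin
  ι m · ι n                ≡⟨ cong₂ _·_ (ι-mkℚ m) (ι-mkℚ n) ⟩
  (+ m ℤ.* + n) / 1        ≡⟨ cong (_/ 1) (sym (ℤ.pos-* m n)) ⟩
  ι (m ℕ.* n)              ∎)

0≤ι : ∀ n → 0ℚ ≤ℚ ι n
0≤ι n = nonNegative⁻¹ (ι n) {{normalize-nonNeg n 1}}

0≤/ : ∀ m d .{{_ : ℕ.NonZero d}} → 0ℚ ≤ℚ + m / d
0≤/ m d = nonNegative⁻¹ (+ m / d) {{normalize-nonNeg m d}}

0≤+ : ∀ {p q} → 0ℚ ≤ℚ p → 0ℚ ≤ℚ q → 0ℚ ≤ℚ p + q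
0≤+ = +-mono-≤

0≤· : ∀ {p q} → 0ℚ ≤ℚ p → 0ℚ ≤ℚ q → 0ℚ ≤ℚ p · q
0≤· {p} {q} 0≤p 0≤q =
  nonNegative⁻¹ (p · q) {{nonNeg*nonNeg⇒nonNeg p {{nonNegative 0≤p}} q {{nonNegative 0≤q}}}}

0≤1-2θ : ∀ a → 0ℚ ≤ℚ ι 1 - ι 2 · θ a
0≤1-2θ 0 = 0≤ι 1
0≤1-2θ 1 = 0≤ι 1
0≤1-2θ 2 = 0≤/ 25 32
0≤1-2θ 3 = 0≤/ 2 7
0≤1-2θ 4 = 0≤/ 2 11
0≤1-2θ a@(suc (suc (suc (suc (suc _))))) =
  subst (0ℚ ≤ℚ_) (sym (1-2[½-u]≡2u (+ 1 / suc (a * a)))) (0≤· (0≤ι 2) (0≤/ 1 (suc (a * a))))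
  where
  1-2[½-u]≡2u : ∀ u → ι 1 - ι 2 · (+ 1 / 2 - u) ≡ ι 2 · u
  1-2[½-u]≡2u = solve 1 (λ u → con (ι 1) :- con (ι 2) :* (con (+ 1 / 2) :- u) := con (ι 2) :* u) refl

Fℚ : ℚ → ℚ → ℚ → ℚ → ℚ
Fℚ A B N t =
  ι 2 + (N + ι 2) · (N - B - ι 2 · t)
      - A · (A + ι 1)
      - (N - A · B) · (N - A · B + ι 1)

P : ℚ → ℚ → ℚ → ℚ
P x y k = (ι 1 + x) · x · y · (y + ι 2) + ι 3 · x · y + (ι 1 + ι 2 · x) · (ι 1 + y) · k

0≤P : ∀ {x y k} → 0ℚ ≤ℚ x → 0ℚ ≤ℚ y → 0ℚ ≤ℚ k → 0ℚ ≤ℚ P x y k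
0≤P 0≤x 0≤y 0≤k =
  0≤+ (0≤+ (0≤· (0≤· (0≤· (0≤+ (0≤ι 1) 0≤x) 0≤x) 0≤y) (0≤+ 0≤y (0≤ι 2)))
           (0≤· (0≤· (0≤ι 3) 0≤x) 0≤y))
      (0≤· (0≤· (0≤+ (0≤ι 1) (0≤· (0≤ι 2) 0≤x)) (0≤+ (0≤ι 1) 0≤y)) 0≤k)

-- R x r t is (a - 3) + (n + 2)(1 - 2t) with a = 1 + x and n + 2 = a + 3 + r.
R : ℚ → ℚ → ℚ → ℚ
R x r t = x - ι 2 + (ι 4 + x + r) · (ι 1 - ι 2 · t)

Fℚ≡P+R : ∀ x y k t →
  Fℚ (ι 1 + x) (ι 1 + y) (ι 1 + ((ι 1 + x) · (ι 1 + y) + k)) t ≡ P x y k + R x (x · y + y + k) t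
Fℚ≡P+R = solve 4 (λ x y k t →
  let c : ℕ → Polynomial 4
      c n = con (ι n)
      A = c 1 :+ x; B = c 1 :+ y; N = c 1 :+ (A :* B :+ k)
  in
  c 2 :+ (N :+ c 2) :* (N :- B :- c 2 :* t) :- A :* (A :+ c 1) :- (N :- A :* B) :* (N :- A :* B :+ c 1)
  := (A :* x :* y :* (y :+ c 2) :+ c 3 :* x :* y :+ (c 1 :+ c 2 :* x) :* B :* k)
     :+ (x :- c 2 :+ (c 4 :+ x :+ (x :* y :+ y :+ k)) :* (c 1 :- c 2 :* t))) refl

0≤R : ∀ x {r} → 0ℚ ≤ℚ r → 0ℚ ≤ℚ R (ι x) r (θ (suc x))
0≤R 0 {r} 0≤r = subst (0ℚ ≤ℚ_) (sym R≡) (0≤+ (0≤ι 2) 0≤r)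
  where
  R≡ : R (ι 0) r (θ 1) ≡ ι 2 + r
  R≡ = solve 1 (λ r →
         con (ι 0) :- con (ι 2) :+ (con (ι 4) :+ con (ι 0) :+ r) :* (con (ι 1) :- con (ι 2) :* con (θ 1))
         := con (ι 2) :+ r) refl r
0≤R 1 {r} 0≤r = subst (0ℚ ≤ℚ_) (sym R≡) (0≤+ (0≤/ 93 32) (0≤· (0≤/ 25 32) 0≤r))
  where
  R≡ : R (ι 1) r (θ 2) ≡ + 93 / 32 + + 25 / 32 · r
  R≡ = solve 1 (λ r →
         con (ι 1) :- con (ι 2) :+ (con (ι 4) :+ con (ι 1) :+ r) :* (con (ι 1) :- con (ι 2) :* con (θ 2))
         := con (+ 93 / 32) :+ con (+ 25 / 32) :* r) refl r
0≤R x@(suc (suc z)) {r} 0≤r = subst (0ℚ ≤ℚ_) (sym R≡) (0≤+ (0≤ι z) 0≤rest)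
  where
  rest : ℚ
  rest = (ι 4 + ι x + r) · (ι 1 - ι 2 · θ (suc x))

  0≤rest : 0ℚ ≤ℚ rest
  0≤rest = 0≤· (0≤+ (0≤+ (0≤ι 4) (0≤ι x)) 0≤r) (0≤1-2θ (suc x))

  R≡ : R (ι x) r (θ (suc x)) ≡ ι z + rest
  R≡ = begin
    ι x - ι 2 + rest            ≡⟨ cong (λ X → X - ι 2 + rest) (ι-+ 2 z) ⟩
    ι 2 + ι z - ι 2 + rest      ≡⟨ solve 2 (λ z s → con (ι 2) :+ z :- con (ι 2) :+ s := z :+ s) refl (ι z) rest ⟩
    ι z + rest                  ∎

F≡P+R : ∀ x y k → let a = suc x; b = suc y in
  F a b (suc (a * b ℕ.+ k)) ≡ P (ι x) (ι y) (ι k) + R (ι x) (ι x · ι y + ι y + ι k) (θ a)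
F≡P+R x y k = begin
  Fℚ (ι a) (ι b) (ι (suc (a * b ℕ.+ k))) (θ a)
    ≡⟨ cong (λ N → Fℚ (ι a) (ι b) N (θ a)) ιn≡ ⟩
  Fℚ (ι a) (ι b) (ι 1 + (ι a · ι b + ι k)) (θ a)
    ≡⟨ cong₂ (λ A B → Fℚ A B (ι 1 + (A · B + ι k)) (θ a)) (ι-+ 1 x) (ι-+ 1 y) ⟩
  Fℚ (ι 1 + ι x) (ι 1 + ι y) (ι 1 + ((ι 1 + ι x) · (ι 1 + ι y) + ι k)) (θ a)
    ≡⟨ Fℚ≡P+R (ι x) (ι y) (ι k) (θ a) ⟩
  P (ι x) (ι y) (ι k) + R (ι x) (ι x · ι y + ι y + ι k) (θ a) ∎
  where
  a b : ℕ
  a = suc x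
  b = suc y

  ιn≡ : ι (suc (a * b ℕ.+ k)) ≡ ι 1 + (ι a · ι b + ι k)
  ιn≡ = begin
    ι (1 ℕ.+ (a * b ℕ.+ k))    ≡⟨ ι-+ 1 (a * b ℕ.+ k) ⟩
    ι 1 + ι (a * b ℕ.+ k)      ≡⟨ cong (λ X → ι 1 + X) (ι-+ (a * b) k) ⟩
    ι 1 + (ι (a * b) + ι k)    ≡⟨ cong (λ X → ι 1 + (X + ι k)) (ι-* a b) ⟩
    ι 1 + (ι a · ι b + ι k)    ∎

lemma23 : (a b n : ℕ) → 1 ≤ a → 1 ≤ b → 2 ≤ n → a * b < n →
    0ℚ ≤ℚ F a b n
lemma23 (suc x) (suc y) n _ _ _ ab<n with m≤n⇒∃[o]m+o≡n ab<n
... | k , refl = subst (0ℚ ≤ℚ_) (sym (F≡P+R x y k))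
  (0≤+ (0≤P (0≤ι x) (0≤ι y) (0≤ι k))
       (0≤R x (0≤+ (0≤+ (0≤· (0≤ι x) (0≤ι y)) (0≤ι y)) (0≤ι k))))
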